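{- Let $D$ be a $7$-located simplicial disc (a triangulated $2$-disc which, as a simplicial complex, is $7$-located). Then any pair of adjacent interior vertices $v,w$ of $D$ satisfy $\deg(v)+\deg(w)\ge 12$.
   Context: $\deg(v)$ is the number of vertices adjacent to $v$. A flag simplicial complex is one in which any finite set of pairwise adjacent vertices spans a simplex. A subcomplex $L$ is full if every simplex whose vertices lie in $L$ is contained in $L$. A cycle is a subcomplex isomorphic to a subdivision of $S^1$, written $(v_1,\dots,v_k)$; its length is its number of edges. A $k$-wheel $(v_0;v_1,\dots,v_k)$ is a cycle $(v_1,\dots,v_k)$ (the boundary) together with all triangles $\langle v_0,v_i,v_{i+1}\rangle$ (indices mod $k$). A $(k,l)$-dwheel $W=W_1\cup W_2$ is the union of two wheels $W_1=(w_l;v_1,\dots,v_k)$ and $W_2=(v_2;w_1,\dots,w_l)$ with $v_3=w_{l-1}$ and either $v_1=w_1$ or $v_1$ adjacent to $w_1$; its boundary is the cycle $(w_1,\dots,w_{l-1}=v_3,v_4,\dots,v_k)$. The link $X_v$ of a vertex $v$ is the subcomplex of simplices disjoint from $v$ spanning a simplex together with $v$. A complex $X$ is $m$-located ($m\ge4$) if it is flag and every dwheel $W=W_1\cup W_2$ whose boundary has length at most $m$ and whose wheels $W_1,W_2$ are full subcomplexes is contained in the link of some vertex. -}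

module Defs where

open import Data.Bool using (Bool; true; false; T; not; _∧_)
open import Data.Nat using (ℕ; zero; suc; _+_; _≤_)
open import Data.Nat.DivMod using (_mod_)
open import Data.Fin using (Fin; zero; suc; toℕ; fromℕ; inject₁)
open import Data.Fin.Properties using (_≟_)
open import Data.Fin.Subset using (Subset; ⁅_⁆; _∪_; _∈_; _∉_; _⊆_; ∣_∣; Nonempty)
open import Data.Vec using (Vec; []; _∷_; tabulate)
open import Data.List using (List; []; _∷_; _++_; map; filter; foldr)
open import Data.Integer using (ℤ; -_; _^_) renaming (_+_ to _+ℤ_; 0ℤ to 0ℤ; 1ℤ to 1ℤ)
open import Data.Product using (Σ; ∃; ∃-syntax; _×_; _,_)
open import Data.Sum using (_⊎_)
open import Relation.Nullary using (¬_; ⌊_⌋)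
open import Relation.Binary.PropositionalEquality using (_≡_; _≢_)
open import Relation.Binary.Construct.Closure.ReflexiveTransitive using (Star)
open import Function.Definitions using (Injective)
open import Function.Bundles using (_⇔_)

record SComplex (n : ℕ) : Set where
  field
    face      : Subset n → Bool
    nonempty  : ∀ σ → T (face σ) → Nonempty σ
    downward  : ∀ σ τ → T (face σ) → τ ⊆ σ → Nonempty τ → T (face τ)
    vertices  : ∀ v → T (face ⁅ v ⁆)

open SComplex public

module _ {n : ℕ} (X : SComplex n) where

  Face : Subset n → Set
  Face σ = T (face X σ)

  edge : Fin n → Fin n → Subset n
  edge u v = ⁅ u ⁆ ∪ ⁅ v ⁆

  triangle : Fin n → Fin n → Fin n → Subset n
  triangle u v w = ⁅ u ⁆ ∪ ⁅ v ⁆ ∪ ⁅ w ⁆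

  Adj : Fin n → Fin n → Set
  Adj u v = u ≢ v × Face (edge u v)

  adjᵇ : Fin n → Fin n → Bool
  adjᵇ u v = not ⌊ u ≟ v ⌋ ∧ face X (edge u v)

  deg : Fin n → ℕ
  deg v = ∣ tabulate (adjᵇ v) ∣

  triCount : Fin n → Fin n → ℕ
  triCount u v =
    ∣ tabulate (λ w → not ⌊ w ≟ u ⌋ ∧ not ⌊ w ≟ v ⌋ ∧ face X (triangle u v w)) ∣

  Flag : Set
  Flag = ∀ σ → Nonempty σ → (∀ u v → u ∈ σ → v ∈ σ → u ≢ v → Adj u v) → Face σ

  InLink : Fin n → Subset n → Set
  InLink u σ = u ∉ σ × Face (σ ∪ ⁅ u ⁆)

next : ∀ {k} → Fin (suc k) → Fin (suc k)
next {k} i = suc (toℕ i) mod (suc k)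

lastIx : ∀ k → Fin (3 + k)
lastIx k = fromℕ (2 + k)

penIx : ∀ k → Fin (3 + k)
penIx k = inject₁ (fromℕ (1 + k))

-- Wheels.  A k-wheel (c; b 0, …, b (k-1)) with k = 3 + k' boundary vertices,
-- given by its centre c and boundary b : Fin (3 + k') → Fin n.

module _ {n : ℕ} (X : SComplex n) where

  IsWheel : ∀ {k} → Fin n → (Fin (3 + k) → Fin n) → Set
  IsWheel c b = Injective _≡_ _≡_ b
              × (∀ i → c ≢ b i)
              × (∀ i → Face X (triangle X c (b i) (b (next i))))

  WheelSimplex : ∀ {k} → Fin n → (Fin (3 + k) → Fin n) → Subset n → Set
  WheelSimplex c b σ =
    σ ≡ ⁅ c ⁆ ⊎
    (∃[ i ] (σ ≡ ⁅ b i ⁆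
          ⊎ σ ≡ edge X c (b i)
          ⊎ σ ≡ edge X (b i) (b (next i))
          ⊎ σ ≡ triangle X c (b i) (b (next i))))

  WheelVertex : ∀ {k} → Fin n → (Fin (3 + k) → Fin n) → Fin n → Set
  WheelVertex c b v = v ≡ c ⊎ ∃[ i ] v ≡ b i

  FullWheel : ∀ {k} → Fin n → (Fin (3 + k) → Fin n) → Set
  FullWheel c b = ∀ σ → Face X σ → (∀ v → v ∈ σ → WheelVertex c b v) → WheelSimplex c b σ

  WheelInLink : ∀ {k} → Fin n → Fin n → (Fin (3 + k) → Fin n) → Set
  WheelInLink u c b = ∀ σ → WheelSimplex c b σ → InLink X u σ

  -- (K, L)-dwheel with K = 3 + k, L = 3 + l:
  --   W₁ = (w_L ; v₁, …, v_K),  W₂ = (v₂ ; w₁, …, w_L)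
  -- with vᵢ = v (i-1), wᵢ = w (i-1).  Boundary (w₁,…,w_{L-1}=v₃,v₄,…,v_K)
  -- has length K + L - 4 = k + l + 2.
  IsDwheel : ∀ {k l} → (Fin (3 + k) → Fin n) → (Fin (3 + l) → Fin n) → Set
  IsDwheel {k} {l} v w =
      IsWheel (w (lastIx l)) v
    × IsWheel (v (suc zero)) w
    × v (suc (suc zero)) ≡ w (penIx l)
    × (v zero ≡ w zero ⊎ Adj X (v zero) (w zero))

  dwheelBoundaryLength : ℕ → ℕ → ℕ
  dwheelBoundaryLength k l = k + l + 2

  Located : ℕ → Set
  Located m =
    Flag X ×
    (∀ k l (v : Fin (3 + k) → Fin n) (w : Fin (3 + l) → Fin n) →
       IsDwheel v w →
       dwheelBoundaryLength k l ≤ m →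
       FullWheel (w (lastIx l)) v →
       FullWheel (v (suc zero)) w →
       ∃[ u ] (WheelInLink u (w (lastIx l)) v × WheelInLink u (v (suc zero)) w))

allSubsets : ∀ n → List (Subset n)
allSubsets zero = [] ∷ []
allSubsets (suc n) = map (true ∷_) (allSubsets n) ++ map (false ∷_) (allSubsets n)

module _ {n : ℕ} (X : SComplex n) where

  -- Euler characteristic: Σ over simplices σ of (-1)^dim σ = (-1)^(|σ|+1)
  euler : ℤ
  euler = foldr (λ σ acc → (if' (face X σ) ((- 1ℤ) ^ suc ∣ σ ∣)) +ℤ acc) 0ℤ (allSubsets n)
    where
      if' : Bool → ℤ → ℤ
      if' true  z = z
      if' false z = 0ℤ

  LinkEdge : Fin n → Fin n → Fin n → Set
  LinkEdge v a c = Adj X v a × Adj X v c × Adj X a c × Face X (triangle X v a c)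

  LinkIsCycle : Fin n → Set
  LinkIsCycle v =
    Σ ℕ λ k → Σ (Fin (3 + k) → Fin n) λ b →
      Injective _≡_ _≡_ b
      × (∀ u → Adj X v u ⇔ (∃[ i ] u ≡ b i))
      × (∀ a c → LinkEdge v a c ⇔
           (∃[ i ] ((a ≡ b i × c ≡ b (next i)) ⊎ (c ≡ b i × a ≡ b (next i)))))

  LinkIsPath : Fin n → Set
  LinkIsPath v =
    Σ ℕ λ k → Σ (Fin (2 + k) → Fin n) λ p →
      Injective _≡_ _≡_ p
      × (∀ u → Adj X v u ⇔ (∃[ i ] u ≡ p i))
      × (∀ a c → LinkEdge v a c ⇔
           (∃[ i ] ((a ≡ p (inject₁ i) × c ≡ p (suc i))
                  ⊎ (c ≡ p (inject₁ i) × a ≡ p (suc i)))))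

  BoundaryEdge : Fin n → Fin n → Set
  BoundaryEdge u v = Adj X u v × triCount X u v ≡ 1

  Interior : Fin n → Set
  Interior v = ∀ u → ¬ BoundaryEdge v u

  -- X is a triangulated 2-disc: a connected combinatorial 2-manifold with
  -- nonempty boundary and Euler characteristic 1
  IsDisc : Set
  IsDisc =
      (∀ σ → Face X σ → ∣ σ ∣ ≤ 3)
    × (∀ v → LinkIsCycle v ⊎ LinkIsPath v)
    × (∀ u v → Star (Adj X) u v)
    × (∃[ u ] ∃[ v ] BoundaryEdge u v)
    × euler ≡ 1ℤ

{-# OPTIONS --safe #-}
module Submission where

-- Let x, y be adjacent interior vertices of D. Their links are cycles, of lengths at most deg x and
-- deg y. Rotating the link of x so that it ends at y, and the link of y so that x is its second
-- vertex (reflecting the first if necessary), the stars of y and x form a dwheel whose boundary has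
-- length at most deg x + deg y - 4. Both stars are full, since D is flag and 2-dimensional. If
-- deg x + deg y ≤ 11, 7-locatedness puts this dwheel into the link of a vertex u, and u together
-- with a triangle of the dwheel spans a 3-simplex, which a disc does not have.

open import Defs
open import Data.Bool using (Bool; T; not; _∧_)
open import Data.Bool.Properties using (T-∧; T-≡)
open import Data.Empty using (⊥-elim)
open import Data.Fin using (Fin; zero; suc; toℕ; fromℕ; inject₁; opposite)
open import Data.Fin.Properties
  using (any?; suc-injective; 0≢1+n; opposite-involutive;
         toℕ-injective; toℕ-fromℕ<; toℕ-inject₁; toℕ<n; toℕ-fromℕ)
  renaming (_≟_ to _≟ᶠ_)
open import Data.Fin.Induction using (<-weakInduction)
open import Data.Fin.Relation.Unary.Top using (view; ‵fromℕ; ‵inject₁)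
open import Data.Fin.Subset using (Subset; ⁅_⁆; _∪_; _-_; _∈_; _⊆_; ∣_∣; Nonempty)
open import Data.Fin.Subset.Properties
  using (_∈?_; x∈⁅x⁆; x∈⁅y⁆⇒x≡y; x∈p∪q⁻; x∈p∪q⁺; ⊆-antisym; ∣⁅x⁆∣≡1;
         x∈p∧x≢y⇒x∈p-y; x∈p⇒∣p-x∣<∣p∣; ∪-comm; ∪-assoc; ⊆-trans; p⊆p∪q)
open import Data.Nat using (ℕ; zero; suc; _+_; _≤_; _<_; z≤n; s≤s)
open import Data.Nat.DivMod using (_%_; m<n⇒m%n≡m; n%n≡0)
open import Data.Nat.Properties using (≤-trans; ≤⇒≯; ≰⇒>; +-monoˡ-≤; +-mono-≤; module ≤-Reasoning)
open import Data.Nat.Tactic.RingSolver using (solve)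
open import Data.List using (_∷_; [])
open import Data.Product using (Σ; ∃-syntax; _×_; _,_; proj₁; proj₂)
open import Data.Sum using (_⊎_; inj₁; inj₂)
import Data.Sum as Sum
open import Data.Vec using (tabulate)
open import Data.Vec.Properties using (lookup∘tabulate; []=⇒lookup; lookup⇒[]=)
open import Function using (_∘_)
open import Function.Bundles using (_⇔_; mk⇔; Equivalence)
open import Function.Definitions using (Injective)
open import Relation.Nullary using (¬_; yes; no; ⌊_⌋)
open import Relation.Nullary.Decidable using (fromWitnessFalse; toWitnessFalse; _×-dec_; ¬?)
open import Relation.Binary.PropositionalEquality
  using (_≡_; _≢_; refl; sym; trans; cong; subst; module ≡-Reasoning)

module _ {n : ℕ} where

  ⁅⁆-⊆ : ∀ {x : Fin n} {p} → x ∈ p → ⁅ x ⁆ ⊆ p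
  ⁅⁆-⊆ {p = p} x∈p y∈⁅x⁆ = subst (_∈ p) (sym (x∈⁅y⁆⇒x≡y _ y∈⁅x⁆)) x∈p

  ∪-⊆ : ∀ {p q r : Subset n} → p ⊆ r → q ⊆ r → p ∪ q ⊆ r
  ∪-⊆ {p} {q} p⊆r q⊆r x∈p∪q with x∈p∪q⁻ p q x∈p∪q
  ... | inj₁ x∈p = p⊆r x∈p
  ... | inj₂ x∈q = q⊆r x∈q

  ⊆⁅x⁆⇒≡⁅x⁆ : ∀ {x : Fin n} {p} → Nonempty p → p ⊆ ⁅ x ⁆ → p ≡ ⁅ x ⁆
  ⊆⁅x⁆⇒≡⁅x⁆ {x} (y , y∈p) p⊆⁅x⁆ =
    ⊆-antisym p⊆⁅x⁆ (⁅⁆-⊆ (subst (_∈ _) (x∈⁅y⁆⇒x≡y x (p⊆⁅x⁆ y∈p)) y∈p))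

  ⊆⁅x⁆∪q⇒≡q⊎≡⁅x⁆∪q : ∀ {x : Fin n} {p q} → p ⊆ ⁅ x ⁆ ∪ q → q ⊆ p → p ≡ q ⊎ p ≡ ⁅ x ⁆ ∪ q
  ⊆⁅x⁆∪q⇒≡q⊎≡⁅x⁆∪q {x} {p} {q} p⊆ q⊆p with x ∈? p
  ... | yes x∈p = inj₂ (⊆-antisym p⊆ (∪-⊆ (⁅⁆-⊆ x∈p) q⊆p))
  ... | no x∉p = inj₁ (⊆-antisym p⊆q q⊆p)
    where
    p⊆q : p ⊆ q
    p⊆q y∈p with x∈p∪q⁻ ⁅ x ⁆ q (p⊆ y∈p)
    ... | inj₁ y∈⁅x⁆ = ⊥-elim (x∉p (subst (_∈ p) (x∈⁅y⁆⇒x≡y x y∈⁅x⁆) y∈p))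
    ... | inj₂ y∈q = y∈q

  ≤∣p-x∣⇒<∣p∣ : ∀ {x : Fin n} {p k} → x ∈ p → k ≤ ∣ p - x ∣ → k < ∣ p ∣
  ≤∣p-x∣⇒<∣p∣ x∈p k≤ = ≤-trans (s≤s k≤) (x∈p⇒∣p-x∣<∣p∣ x∈p)

injection⇒≤∣p∣ : ∀ {m n} {p : Subset n} (f : Fin m → Fin n) →
                Injective _≡_ _≡_ f → (∀ i → f i ∈ p) → m ≤ ∣ p ∣
injection⇒≤∣p∣ {zero} f f-inj f∈p = z≤n
injection⇒≤∣p∣ {suc m} f f-inj f∈p =
  ≤∣p-x∣⇒<∣p∣ (f∈p zero) (injection⇒≤∣p∣ (f ∘ suc) (suc-injective ∘ f-inj)
                            (λ i → x∈p∧x≢y⇒x∈p-y (f∈p (suc i)) (0≢1+n ∘ f-inj ∘ sym)))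

module _ {n : ℕ} {p : Subset n} {a b c : Fin n} where

  ∣p∣≤3⇒⊆triangle : ∣ p ∣ ≤ 3 → a ∈ p → b ∈ p → c ∈ p → a ≢ b → a ≢ c → b ≢ c →
                    p ⊆ ⁅ a ⁆ ∪ ⁅ b ⁆ ∪ ⁅ c ⁆
  ∣p∣≤3⇒⊆triangle ∣p∣≤3 a∈p b∈p c∈p a≢b a≢c b≢c {x} x∈p
    with x ≟ᶠ a | x ≟ᶠ b | x ≟ᶠ c
  ... | yes refl | _ | _ = x∈p∪q⁺ (inj₁ (x∈⁅x⁆ x))
  ... | no _ | yes refl | _ = x∈p∪q⁺ (inj₂ (x∈p∪q⁺ (inj₁ (x∈⁅x⁆ x))))
  ... | no _ | no _ | yes refl = x∈p∪q⁺ (inj₂ (x∈p∪q⁺ {p = ⁅ b ⁆} (inj₂ (x∈⁅x⁆ x))))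
  ... | no x≢a | no x≢b | no x≢c = ⊥-elim (≤⇒≯ ∣p∣≤3 4≤∣p∣)
    where
    remove : ∀ {y z : Fin n} {q} → y ∈ q → y ≢ z → y ∈ q - z
    remove = x∈p∧x≢y⇒x∈p-y
    4≤∣p∣ : 4 ≤ ∣ p ∣
    4≤∣p∣ = ≤∣p-x∣⇒<∣p∣ a∈p (≤∣p-x∣⇒<∣p∣ (remove b∈p (a≢b ∘ sym))
              (≤∣p-x∣⇒<∣p∣ (remove (remove c∈p (a≢c ∘ sym)) (b≢c ∘ sym))
              (≤∣p-x∣⇒<∣p∣ (remove (remove (remove x∈p x≢a) x≢b) x≢c) z≤n)))

module _ {n : ℕ} (g : Fin n → Bool) where

  ∈-tabulate⁺ : ∀ {x} → T (g x) → x ∈ tabulate g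
  ∈-tabulate⁺ {x} gx = lookup⇒[]= x _ (trans (lookup∘tabulate g x) (Equivalence.to T-≡ gx))

  ∈-tabulate⁻ : ∀ {x} → x ∈ tabulate g → T (g x)
  ∈-tabulate⁻ {x} x∈ = Equivalence.from T-≡ (trans (sym (lookup∘tabulate g x)) ([]=⇒lookup x∈))

module _ {m : ℕ} where

  next-inject₁ : (i : Fin m) → next (inject₁ i) ≡ suc i
  next-inject₁ i = toℕ-injective (begin
    toℕ (next (inject₁ i))          ≡⟨ toℕ-fromℕ< _ ⟩
    suc (toℕ (inject₁ i)) % suc m   ≡⟨ cong (λ j → suc j % suc m) (toℕ-inject₁ i) ⟩
    suc (toℕ i) % suc m             ≡⟨ m<n⇒m%n≡m (s≤s (toℕ<n i)) ⟩
    suc (toℕ i)                     ∎)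
    where open ≡-Reasoning

  next-fromℕ : next (fromℕ m) ≡ zero
  next-fromℕ = toℕ-injective (begin
    toℕ (next (fromℕ m))          ≡⟨ toℕ-fromℕ< _ ⟩
    suc (toℕ (fromℕ m)) % suc m   ≡⟨ cong (λ j → suc j % suc m) (toℕ-fromℕ m) ⟩
    suc m % suc m                 ≡⟨ n%n≡0 (suc m) ⟩
    zero                          ∎)
    where open ≡-Reasoning

prev : ∀ {m} → Fin (suc m) → Fin (suc m)
prev zero    = fromℕ _
prev (suc i) = inject₁ i

next-prev : ∀ {m} (i : Fin (suc m)) → next (prev i) ≡ i
next-prev zero    = next-fromℕ
next-prev (suc i) = next-inject₁ i

prev-next : ∀ {m} (i : Fin (suc m)) → prev (next i) ≡ i
prev-next i with view i
... | ‵fromℕ     = cong prev next-fromℕ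
... | ‵inject₁ j = cong prev (next-inject₁ j)

opposite-fromℕ : ∀ m → opposite (fromℕ m) ≡ zero
opposite-fromℕ zero    = refl
opposite-fromℕ (suc m) = cong inject₁ (opposite-fromℕ m)

opposite-inject₁ : ∀ {m} (i : Fin m) → opposite (inject₁ i) ≡ suc (opposite i)
opposite-inject₁ zero    = refl
opposite-inject₁ (suc i) = cong inject₁ (opposite-inject₁ i)

opposite-next : ∀ {m} (i : Fin (suc m)) → opposite (next i) ≡ prev (opposite i)
opposite-next i with view i
... | ‵fromℕ     = trans (cong opposite next-fromℕ) (cong prev (sym (opposite-fromℕ _)))
... | ‵inject₁ j = trans (cong opposite (next-inject₁ j)) (cong prev (sym (opposite-inject₁ j)))

SamePair : ∀ {A : Set} → A → A → A → A → Set
SamePair a c p q = (a ≡ p × c ≡ q) ⊎ (c ≡ p × a ≡ q)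

SamePair-map : ∀ {A B : Set} (f : A → B) {a c p q} →
               SamePair a c p q → SamePair (f a) (f c) (f p) (f q)
SamePair-map f (inj₁ (refl , refl)) = inj₁ (refl , refl)
SamePair-map f (inj₂ (refl , refl)) = inj₂ (refl , refl)

SamePair-trans : ∀ {A : Set} {a c p q r s : A} →
                 SamePair a c p q → SamePair p q r s → SamePair a c r s
SamePair-trans (inj₁ (refl , refl)) pq~rs = pq~rs
SamePair-trans (inj₂ (refl , refl)) (inj₁ (refl , refl)) = inj₂ (refl , refl)
SamePair-trans (inj₂ (refl , refl)) (inj₂ (refl , refl)) = inj₁ (refl , refl)

distinct-members⇒SamePair : ∀ {A : Set} {a c p q : A} →
                            a ≡ p ⊎ a ≡ q → c ≡ p ⊎ c ≡ q → a ≢ c → SamePair a c p q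
distinct-members⇒SamePair (inj₁ refl) (inj₁ refl) a≢c = ⊥-elim (a≢c refl)
distinct-members⇒SamePair (inj₁ a≡p)  (inj₂ c≡q)  _   = inj₁ (a≡p , c≡q)
distinct-members⇒SamePair (inj₂ a≡q)  (inj₁ c≡p)  _   = inj₂ (c≡p , a≡q)
distinct-members⇒SamePair (inj₂ refl) (inj₂ refl) a≢c = ⊥-elim (a≢c refl)

SamePair⇒edge≡ : ∀ {n} {a c p q : Fin n} → SamePair a c p q → ⁅ a ⁆ ∪ ⁅ c ⁆ ≡ ⁅ p ⁆ ∪ ⁅ q ⁆
SamePair⇒edge≡ (inj₁ (refl , refl)) = refl
SamePair⇒edge≡ (inj₂ (refl , refl)) = ∪-comm _ _

CycleEdge : ∀ {A : Set} {m} → (Fin (suc m) → A) → A → A → Set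
CycleEdge b a c = ∃[ i ] SamePair a c (b i) (b (next i))

PreservesCycleEdges : ∀ {m} → (Fin (suc m) → Fin (suc m)) → Set
PreservesCycleEdges f = ∀ i → CycleEdge (λ j → j) (f i) (f (next i))

CycleEdge-transport : ∀ {A : Set} {m} {b b′ : Fin (suc m) → A} {h a c} → PreservesCycleEdges h →
                      (∀ i → b i ≡ b′ (h i)) → CycleEdge b a c → CycleEdge b′ a c
CycleEdge-transport {b′ = b′} {h} h-edges b≡b′∘h (i , ac~) with h-edges i
... | j , hi~ =
  j , SamePair-trans ac~ (SamePair-trans (inj₁ (b≡b′∘h i , b≡b′∘h (next i))) (SamePair-map b′ hi~))

record CycleSymmetry (m : ℕ) : Set where
  field
    to from      : Fin (suc m) → Fin (suc m)
    to∘from      : ∀ i → to (from i) ≡ i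
    from∘to      : ∀ i → from (to i) ≡ i
    to-edges     : PreservesCycleEdges to
    from-edges   : PreservesCycleEdges from

rotation : ∀ {m} → CycleSymmetry m
rotation = record
  { to = next ; from = prev ; to∘from = next-prev ; from∘to = prev-next
  ; to-edges = λ i → next i , inj₁ (refl , refl)
  ; from-edges = λ i → prev i , inj₁ (refl , trans (prev-next i) (sym (next-prev i)))
  }

inverse : ∀ {m} → CycleSymmetry m → CycleSymmetry m
inverse s = record
  { to = from ; from = to ; to∘from = from∘to ; from∘to = to∘from
  ; to-edges = from-edges ; from-edges = to-edges }
  where open CycleSymmetry s

reflection : ∀ {m} → CycleSymmetry m
reflection = record
  { to = opposite ; from = opposite ; to∘from = opposite-involutive ; from∘to = opposite-involutive
  ; to-edges = opposite-edges ; from-edges = opposite-edges }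
  where
  opposite-edges : PreservesCycleEdges opposite
  opposite-edges i = opposite (next i) ,
    inj₂ (refl , sym (trans (cong next (opposite-next i)) (next-prev (opposite i))))

module _ {n : ℕ} (X : SComplex n) where

  Dimension≤2 : Set
  Dimension≤2 = ∀ σ → Face X σ → ∣ σ ∣ ≤ 3

  ∈edge₁ : ∀ {a b} → a ∈ edge X a b
  ∈edge₁ {a} = x∈p∪q⁺ (inj₁ (x∈⁅x⁆ a))

  ∈edge₂ : ∀ {a b} → b ∈ edge X a b
  ∈edge₂ {b = b} = x∈p∪q⁺ (inj₂ (x∈⁅x⁆ b))

  ∈triangle₁ : ∀ {a b c} → a ∈ triangle X a b c
  ∈triangle₁ {a} = x∈p∪q⁺ (inj₁ (x∈⁅x⁆ a))

  ∈triangle₂ : ∀ {a b c} → b ∈ triangle X a b c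
  ∈triangle₂ {b = b} {c} = x∈p∪q⁺ (inj₂ (∈edge₁ {b} {c}))

  ∈triangle₃ : ∀ {a b c} → c ∈ triangle X a b c
  ∈triangle₃ {b = b} {c} = x∈p∪q⁺ (inj₂ (∈edge₂ {b} {c}))

  triangle-swap₁₂ : ∀ {a b c} → triangle X a b c ≡ triangle X b a c
  triangle-swap₁₂ {a} {b} {c} = begin
    ⁅ a ⁆ ∪ ⁅ b ⁆ ∪ ⁅ c ⁆     ≡⟨ sym (∪-assoc ⁅ a ⁆ ⁅ b ⁆ ⁅ c ⁆) ⟩
    (⁅ a ⁆ ∪ ⁅ b ⁆) ∪ ⁅ c ⁆   ≡⟨ cong (_∪ ⁅ c ⁆) (∪-comm ⁅ a ⁆ ⁅ b ⁆) ⟩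
    (⁅ b ⁆ ∪ ⁅ a ⁆) ∪ ⁅ c ⁆   ≡⟨ ∪-assoc ⁅ b ⁆ ⁅ a ⁆ ⁅ c ⁆ ⟩
    ⁅ b ⁆ ∪ ⁅ a ⁆ ∪ ⁅ c ⁆     ∎
    where open ≡-Reasoning

  triangle-swap₂₃ : ∀ {a b c} → triangle X a b c ≡ triangle X a c b
  triangle-swap₂₃ {a} {b} {c} = cong (⁅ a ⁆ ∪_) (∪-comm ⁅ b ⁆ ⁅ c ⁆)

  face⇒adj : ∀ {σ a b} → Face X σ → a ∈ σ → b ∈ σ → a ≢ b → Adj X a b
  face⇒adj {σ} σ-face a∈σ b∈σ a≢b =
    a≢b , downward X σ _ σ-face (∪-⊆ (⁅⁆-⊆ a∈σ) (⁅⁆-⊆ b∈σ)) (_ , ∈edge₁)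

  adj-sym : ∀ {a b} → Adj X a b → Adj X b a
  adj-sym {a} {b} (a≢b , ab-face) = a≢b ∘ sym , subst (Face X) (∪-comm ⁅ a ⁆ ⁅ b ⁆) ab-face

  triangle⇒linkEdge : ∀ {v a c} → Face X (triangle X v a c) →
                      v ≢ a → v ≢ c → a ≢ c → LinkEdge X v a c
  triangle⇒linkEdge t v≢a v≢c a≢c =
    face⇒adj t ∈triangle₁ ∈triangle₂ v≢a , face⇒adj t ∈triangle₁ ∈triangle₃ v≢c ,
    face⇒adj t ∈triangle₂ ∈triangle₃ a≢c , t

  linkEdge-swap₁₂ : ∀ {v a c} → LinkEdge X v a c → LinkEdge X a v c
  linkEdge-swap₁₂ (v~a , v~c , a~c , t) = adj-sym v~a , a~c , v~c , subst (Face X) triangle-swap₁₂ t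

  linkEdge-swap₂₃ : ∀ {v a c} → LinkEdge X v a c → LinkEdge X v c a
  linkEdge-swap₂₃ (v~a , v~c , a~c , t) = v~c , v~a , adj-sym a~c , subst (Face X) triangle-swap₂₃ t

  adjᵇ-complete : ∀ {u v} → Adj X u v → T (adjᵇ X u v)
  adjᵇ-complete (u≢v , uv-face) = Equivalence.from T-∧ (fromWitnessFalse u≢v , uv-face)

  record IsLinkCycle (v : Fin n) {k : ℕ} (b : Fin (3 + k) → Fin n) : Set where
    field
      injective : Injective _≡_ _≡_ b
      adj⇔      : ∀ u → Adj X v u ⇔ (∃[ i ] u ≡ b i)
      linkEdge⇔ : ∀ a c → LinkEdge X v a c ⇔ CycleEdge b a c

    adj : ∀ i → Adj X v (b i)
    adj i = Equivalence.from (adj⇔ (b i)) (i , refl)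

    linkEdge : ∀ i → LinkEdge X v (b i) (b (next i))
    linkEdge i = Equivalence.from (linkEdge⇔ _ _) (i , inj₁ (refl , refl))

  open IsLinkCycle

  LinkIsCycle⇒IsLinkCycle : ∀ {v} → LinkIsCycle X v →
                            Σ ℕ λ k → Σ (Fin (3 + k) → Fin n) (IsLinkCycle v)
  LinkIsCycle⇒IsLinkCycle (k , b , b-inj , b-adj , b-edges) = k , b , record
    { injective = b-inj ; adj⇔ = b-adj ; linkEdge⇔ = b-edges }

  IsLinkCycle-∘ : ∀ {v k} {b : Fin (3 + k) → Fin n} (s : CycleSymmetry (2 + k)) →
                  IsLinkCycle v b → IsLinkCycle v (b ∘ CycleSymmetry.to s)
  IsLinkCycle-∘ {b = b} s cyc = record
    { injective = λ e → trans (sym (from∘to _)) (trans (cong from (injective cyc e)) (from∘to _))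
    ; adj⇔ = λ u → mk⇔
        (λ v~u → let (i , u≡bi) = Equivalence.to (adj⇔ cyc u) v~u
                 in from i , trans u≡bi (cong b (sym (to∘from i))))
        (λ (i , u≡bti) → Equivalence.from (adj⇔ cyc u) (to i , u≡bti))
    ; linkEdge⇔ = λ a c → mk⇔
        (CycleEdge-transport from-edges (λ i → cong b (sym (to∘from i)))
           ∘ Equivalence.to (linkEdge⇔ cyc a c))
        (Equivalence.from (linkEdge⇔ cyc a c) ∘ CycleEdge-transport to-edges (λ _ → refl))
    }
    where open CycleSymmetry s

  rotate-to : ∀ {v k} {b : Fin (3 + k) → Fin n} → IsLinkCycle v b → ∀ j p →
              Σ (Fin (3 + k) → Fin n) λ b′ → IsLinkCycle v b′ × b′ p ≡ b j
  rotate-to {v} {k} cyc j p = <-weakInduction MovesTo to-zero to-suc p j cyc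
    where
    MovesTo : Fin (3 + k) → Set
    MovesTo p = ∀ j {b} → IsLinkCycle v b →
                Σ (Fin (3 + k) → Fin n) λ b′ → IsLinkCycle v b′ × b′ p ≡ b j

    to-zero : MovesTo zero
    to-zero = <-weakInduction _ (λ cyc → _ , cyc , refl) λ j ih {b} cyc →
      let (b′ , cyc′ , b′0≡bj) = ih (IsLinkCycle-∘ rotation cyc)
      in b′ , cyc′ , trans b′0≡bj (cong b (next-inject₁ j))

    to-suc : ∀ p → MovesTo (inject₁ p) → MovesTo (suc p)
    to-suc p ih j cyc =
      let (b′ , cyc′ , b′p≡bj) = ih j cyc
      in b′ ∘ prev , IsLinkCycle-∘ (inverse rotation) cyc′ , b′p≡bj

  reflect-fixing-last : ∀ {v k} {b : Fin (3 + k) → Fin n} → IsLinkCycle v b →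
    Σ (Fin (3 + k) → Fin n) λ b′ → IsLinkCycle v b′
      × b′ (lastIx k) ≡ b (lastIx k) × b′ zero ≡ b (penIx k) × b′ (penIx k) ≡ b zero
  reflect-fixing-last {k = k} {b} cyc =
    b ∘ opposite ∘ next , IsLinkCycle-∘ rotation (IsLinkCycle-∘ reflection cyc) ,
    cong (b ∘ opposite) next-fromℕ ,
    cong (b ∘ opposite) (next-inject₁ zero) ,
    cong b (trans (cong opposite (next-inject₁ (fromℕ (1 + k)))) (opposite-fromℕ (2 + k)))

  IsLinkCycle⇒3+k≤deg : ∀ {v k} {b : Fin (3 + k) → Fin n} → IsLinkCycle v b → 3 + k ≤ deg X v
  IsLinkCycle⇒3+k≤deg {v} {b = b} cyc =
    injection⇒≤∣p∣ b (injective cyc) (λ i → ∈-tabulate⁺ (adjᵇ X v) (adjᵇ-complete (adj cyc i)))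

  LinkIsPath⇒boundaryEdge : ∀ {v} → LinkIsPath X v → ∃[ u ] BoundaryEdge X v u
  -- The edge from v to the end p₀ of its link path lies only in the triangle v p₀ p₁.
  LinkIsPath⇒boundaryEdge {v} (k , p , p-inj , p-adj , p-edges) = p zero , v~p0 , triCount≡1
    where
    v~p0 : Adj X v (p zero)
    v~p0 = Equivalence.from (p-adj (p zero)) (zero , refl)

    p0p1 : LinkEdge X v (p zero) (p (suc zero))
    p0p1 = Equivalence.from (p-edges _ _) (zero , inj₁ (refl , refl))

    inTriangle : Fin n → Bool
    inTriangle w = not ⌊ w ≟ᶠ v ⌋ ∧ not ⌊ w ≟ᶠ p zero ⌋ ∧ face X (triangle X v (p zero) w)

    only-p1 : tabulate inTriangle ⊆ ⁅ p (suc zero) ⁆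
    only-p1 {w} w∈ with Equivalence.to (T-∧ {not ⌊ w ≟ᶠ v ⌋}) (∈-tabulate⁻ inTriangle w∈)
    ... | w≢v , rest with Equivalence.to (T-∧ {not ⌊ w ≟ᶠ p zero ⌋}) rest
    ... | w≢p0 , t with Equivalence.to (p-edges (p zero) w)
                         (triangle⇒linkEdge t (proj₁ v~p0)
                           (toWitnessFalse w≢v ∘ sym) (toWitnessFalse w≢p0 ∘ sym))
    ... | zero  , inj₁ (_ , refl) = x∈⁅x⁆ _
    ... | suc i , inj₁ (p0≡pi , _) with p-inj p0≡pi
    ... | ()
    only-p1 {w} w∈ | _ | _ | i , inj₂ (_ , p0≡psi) with p-inj p0≡psi
    ... | ()

    p1∈ : p (suc zero) ∈ tabulate inTriangle
    p1∈ = let (_ , v~p1 , p0~p1 , t) = p0p1 in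
      ∈-tabulate⁺ inTriangle (Equivalence.from (T-∧ {not ⌊ p (suc zero) ≟ᶠ v ⌋})
        (fromWitnessFalse (proj₁ v~p1 ∘ sym) ,
         Equivalence.from (T-∧ {not ⌊ p (suc zero) ≟ᶠ p zero ⌋})
           (fromWitnessFalse (proj₁ p0~p1 ∘ sym) , t)))

    triCount≡1 : triCount X v (p zero) ≡ 1
    triCount≡1 = trans (cong ∣_∣ (⊆-antisym only-p1 (⁅⁆-⊆ p1∈))) (∣⁅x⁆∣≡1 (p (suc zero)))

  interior⇒IsLinkCycle : (∀ v → LinkIsCycle X v ⊎ LinkIsPath X v) →
                         ∀ {v} → Interior X v → Σ ℕ λ k → Σ (Fin (3 + k) → Fin n) (IsLinkCycle v)
  interior⇒IsLinkCycle links {v} v-interior with links v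
  ... | inj₁ cycle = LinkIsCycle⇒IsLinkCycle cycle
  ... | inj₂ path  =
    let (u , boundary) = LinkIsPath⇒boundaryEdge path in ⊥-elim (v-interior u boundary)

  IsLinkCycle⇒IsWheel : ∀ {c k} {b : Fin (3 + k) → Fin n} → IsLinkCycle c b → IsWheel X c b
  IsLinkCycle⇒IsWheel cyc =
    injective cyc , (λ i → proj₁ (adj cyc i)) , (λ i → proj₂ (proj₂ (proj₂ (linkEdge cyc i))))

  module _ (flag : Flag X) (dim : Dimension≤2)
           {c k} {b : Fin (3 + k) → Fin n} (cyc : IsLinkCycle c b) where

    centre-adj : ∀ {u} → WheelVertex X c b u → u ≢ c → Adj X c u
    centre-adj (inj₁ u≡c)      u≢c = ⊥-elim (u≢c u≡c)
    centre-adj (inj₂ (i , refl)) _ = adj cyc i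

    cone-face : ∀ {σ} → Face X σ → (∀ u → u ∈ σ → WheelVertex X c b u) → Face X (σ ∪ ⁅ c ⁆)
    cone-face {σ} σ-face σ⊆W = flag (σ ∪ ⁅ c ⁆) (c , x∈p∪q⁺ (inj₂ (x∈⁅x⁆ c))) pairwise-adj
      where
      pairwise-adj : ∀ u u′ → u ∈ σ ∪ ⁅ c ⁆ → u′ ∈ σ ∪ ⁅ c ⁆ → u ≢ u′ → Adj X u u′
      pairwise-adj u u′ u∈ u′∈ u≢u′ with x∈p∪q⁻ σ ⁅ c ⁆ u∈ | x∈p∪q⁻ σ ⁅ c ⁆ u′∈
      ... | inj₁ u∈σ | inj₁ u′∈σ = face⇒adj σ-face u∈σ u′∈σ u≢u′
      ... | inj₁ u∈σ | inj₂ u′∈⁅c⁆ rewrite x∈⁅y⁆⇒x≡y c u′∈⁅c⁆ = adj-sym (centre-adj (σ⊆W u u∈σ) u≢u′)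
      ... | inj₂ u∈⁅c⁆ | inj₁ u′∈σ rewrite x∈⁅y⁆⇒x≡y c u∈⁅c⁆ = centre-adj (σ⊆W u′ u′∈σ) (u≢u′ ∘ sym)
      ... | inj₂ u∈⁅c⁆ | inj₂ u′∈⁅c⁆ =
        ⊥-elim (u≢u′ (trans (x∈⁅y⁆⇒x≡y c u∈⁅c⁆) (sym (x∈⁅y⁆⇒x≡y c u′∈⁅c⁆))))

    vertex-or-spoke : ∀ {σ} i → σ ≡ ⁅ b i ⁆ ⊎ σ ≡ edge X c (b i) → WheelSimplex X c b σ
    vertex-or-spoke i (inj₁ σ≡) = inj₂ (i , inj₁ σ≡)
    vertex-or-spoke i (inj₂ σ≡) = inj₂ (i , inj₂ (inj₁ σ≡))

    rim-or-triangle : ∀ {σ} i → σ ≡ edge X (b i) (b (next i)) ⊎ σ ≡ triangle X c (b i) (b (next i)) →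
                      WheelSimplex X c b σ
    rim-or-triangle i (inj₁ σ≡) = inj₂ (i , inj₂ (inj₂ (inj₁ σ≡)))
    rim-or-triangle i (inj₂ σ≡) = inj₂ (i , inj₂ (inj₂ (inj₂ σ≡)))

    two-rim-vertices : ∀ {σ i z} → Face X σ → (∀ u → u ∈ σ → WheelVertex X c b u) →
                       b i ∈ σ → z ∈ σ → c ≢ b i → c ≢ z → b i ≢ z → WheelSimplex X c b σ
    two-rim-vertices {σ} {i} {z} σ-face σ⊆W bi∈σ z∈σ c≢bi c≢z bi≢z =
      rim-or-triangle l (Sum.map (λ σ≡ → trans σ≡ bi,z≡rim) (λ σ≡ → trans σ≡ (cong (⁅ c ⁆ ∪_) bi,z≡rim))
        (⊆⁅x⁆∪q⇒≡q⊎≡⁅x⁆∪q (⊆-trans (p⊆p∪q ⁅ c ⁆) τ⊆triangle) (∪-⊆ (⁅⁆-⊆ bi∈σ) (⁅⁆-⊆ z∈σ))))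
      where
      τ-face : Face X (σ ∪ ⁅ c ⁆)
      τ-face = cone-face σ-face σ⊆W

      c∈τ : c ∈ σ ∪ ⁅ c ⁆
      c∈τ = x∈p∪q⁺ (inj₂ (x∈⁅x⁆ c))

      τ⊆triangle : σ ∪ ⁅ c ⁆ ⊆ triangle X c (b i) z
      τ⊆triangle = ∣p∣≤3⇒⊆triangle (dim _ τ-face) c∈τ (x∈p∪q⁺ (inj₁ bi∈σ)) (x∈p∪q⁺ (inj₁ z∈σ))
                     c≢bi c≢z bi≢z

      triangle-face : Face X (triangle X c (b i) z)
      triangle-face = downward X _ _ τ-face
        (∪-⊆ (⁅⁆-⊆ c∈τ) (∪-⊆ (⁅⁆-⊆ (x∈p∪q⁺ (inj₁ bi∈σ))) (⁅⁆-⊆ (x∈p∪q⁺ (inj₁ z∈σ))))) (c , ∈triangle₁)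

      rim-edge : CycleEdge b (b i) z
      rim-edge = Equivalence.to (linkEdge⇔ cyc _ _) (triangle⇒linkEdge triangle-face c≢bi c≢z bi≢z)

      l : Fin (3 + k)
      l = proj₁ rim-edge

      bi,z≡rim : edge X (b i) z ≡ edge X (b l) (b (next l))
      bi,z≡rim = SamePair⇒edge≡ (proj₂ rim-edge)

    IsLinkCycle⇒FullWheel : FullWheel X c b
    IsLinkCycle⇒FullWheel σ σ-face σ⊆W with any? (λ y → y ∈? σ ×-dec ¬? (y ≟ᶠ c))
    ... | no no-other = inj₁ (⊆⁅x⁆⇒≡⁅x⁆ (nonempty X σ σ-face) σ⊆⁅c⁆)
      where
      σ⊆⁅c⁆ : σ ⊆ ⁅ c ⁆
      σ⊆⁅c⁆ {y} y∈σ with y ≟ᶠ c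
      ... | yes refl = x∈⁅x⁆ c
      ... | no y≢c = ⊥-elim (no-other (y , y∈σ , y≢c))
    ... | yes (y , y∈σ , y≢c) with σ⊆W y y∈σ
    ...   | inj₁ y≡c = ⊥-elim (y≢c y≡c)
    ...   | inj₂ (i , refl) with any? (λ z → z ∈? σ ×-dec ¬? (z ≟ᶠ c) ×-dec ¬? (z ≟ᶠ b i))
    ...     | no no-third = vertex-or-spoke i (⊆⁅x⁆∪q⇒≡q⊎≡⁅x⁆∪q σ⊆ (⁅⁆-⊆ y∈σ))
      where
      σ⊆ : σ ⊆ ⁅ c ⁆ ∪ ⁅ b i ⁆
      σ⊆ {z} z∈σ with z ≟ᶠ c | z ≟ᶠ b i
      ... | yes refl | _ = ∈edge₁
      ... | no _ | yes refl = ∈edge₂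
      ... | no z≢c | no z≢bi = ⊥-elim (no-third (z , z∈σ , z≢c , z≢bi))
    ...     | yes (z , z∈σ , z≢c , z≢bi) =
      two-rim-vertices σ-face σ⊆W y∈σ z∈σ (y≢c ∘ sym) (z≢c ∘ sym) (z≢bi ∘ sym)

  FullDwheel : ∀ {k l} → (Fin (3 + k) → Fin n) → (Fin (3 + l) → Fin n) → Set
  FullDwheel {l = l} v w = IsDwheel X v w × FullWheel X (w (lastIx l)) v × FullWheel X (v (suc zero)) w

  linkEdge-last : ∀ {x k a} {b : Fin (3 + k) → Fin n} → IsLinkCycle x b →
                  LinkEdge X x (b (lastIx k)) a → a ≡ b zero ⊎ a ≡ b (penIx k)
  linkEdge-last {k = k} {b = b} cyc x-last-a with Equivalence.to (linkEdge⇔ cyc _ _) x-last-a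
  ... | i , inj₁ (last≡bi , a≡bsi) =
    inj₁ (trans a≡bsi (cong b (trans (cong next (sym (injective cyc last≡bi))) next-fromℕ)))
  ... | i , inj₂ (a≡bi , last≡bsi) =
    inj₂ (trans a≡bi (cong b (trans (sym (prev-next i)) (cong prev (sym (injective cyc last≡bsi))))))

  module _ (flag : Flag X) (dim : Dimension≤2) where

    aligned⇒FullDwheel : ∀ {k l} {v : Fin (3 + k) → Fin n} {w : Fin (3 + l) → Fin n} →
      IsLinkCycle (w (lastIx l)) v → IsLinkCycle (v (suc zero)) w →
      v (suc (suc zero)) ≡ w (penIx l) → v zero ≡ w zero → FullDwheel v w
    aligned⇒FullDwheel v-cyc w-cyc v2≡wpen v0≡w0 =
      (IsLinkCycle⇒IsWheel v-cyc , IsLinkCycle⇒IsWheel w-cyc , v2≡wpen , inj₁ v0≡w0) ,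
      IsLinkCycle⇒FullWheel flag dim v-cyc , IsLinkCycle⇒FullWheel flag dim w-cyc

    centred⇒FullDwheel : ∀ {k l} {v : Fin (3 + k) → Fin n} {w : Fin (3 + l) → Fin n} →
      IsLinkCycle (w (lastIx l)) v → IsLinkCycle (v (suc zero)) w →
      Σ (Fin (3 + l) → Fin n) (FullDwheel v)
    -- v₀ and v₂ are the neighbours of x = v₁ in the link of y, so both span triangles with the edge
    -- xy and hence are the neighbours w₀, w_pen of y = w_last in the link of x.
    centred⇒FullDwheel {k} {l} {v} {w} v-cyc w-cyc
      with distinct-members⇒SamePair (linkEdge-last w-cyc v0-edge) (linkEdge-last w-cyc v2-edge) v0≢v2
      where
      v0-edge : LinkEdge X (v (suc zero)) (w (lastIx l)) (v zero)
      v0-edge = linkEdge-swap₁₂ (linkEdge-swap₂₃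
        (subst (LinkEdge X _ (v zero)) (cong v (next-inject₁ zero)) (linkEdge v-cyc zero)))
      v2-edge : LinkEdge X (v (suc zero)) (w (lastIx l)) (v (suc (suc zero)))
      v2-edge = linkEdge-swap₁₂
        (subst (LinkEdge X _ (v (suc zero))) (cong v (next-inject₁ (suc zero)))
          (linkEdge v-cyc (suc zero)))
      v0≢v2 : v zero ≢ v (suc (suc zero))
      v0≢v2 = 0≢1+n ∘ injective v-cyc
    ... | inj₁ (v0≡w0 , v2≡wpen) = w , aligned⇒FullDwheel v-cyc w-cyc v2≡wpen v0≡w0
    ... | inj₂ (v2≡w0 , v0≡wpen) =
      let (w′ , w′-cyc , w′last≡wlast , w′0≡wpen , w′pen≡w0) = reflect-fixing-last w-cyc
      in w′ , aligned⇒FullDwheel (subst (λ c → IsLinkCycle c v) (sym w′last≡wlast) v-cyc) w′-cyc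
                (trans v2≡w0 (sym w′pen≡w0)) (trans v0≡wpen (sym w′0≡wpen))

    adjacent⇒FullDwheel : ∀ {x y kx ky} {bx : Fin (3 + kx) → Fin n} {by : Fin (3 + ky) → Fin n} →
      Adj X x y → IsLinkCycle x bx → IsLinkCycle y by →
      Σ (Fin (3 + ky) → Fin n) λ v → Σ (Fin (3 + kx) → Fin n) (FullDwheel v)
    adjacent⇒FullDwheel {x} {y} {kx} x~y bx-cyc by-cyc
      with Equivalence.to (adj⇔ bx-cyc y) x~y | Equivalence.to (adj⇔ by-cyc x) (adj-sym x~y)
    ... | jy , y≡bxjy | jx , x≡byjx
      with rotate-to bx-cyc jy (lastIx kx) | rotate-to by-cyc jx (suc zero)
    ... | w , w-cyc , wlast≡bxjy | v , v-cyc , v1≡byjx =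
      v , centred⇒FullDwheel (subst (λ c → IsLinkCycle c v) (trans y≡bxjy (sym wlast≡bxjy)) v-cyc)
                             (subst (λ c → IsLinkCycle c w) (trans x≡byjx (sym v1≡byjx)) w-cyc)

  noShortFullDwheel : ∀ {m k l} {v : Fin (3 + k) → Fin n} {w : Fin (3 + l) → Fin n} →
    Dimension≤2 → Located X m → FullDwheel v w → ¬ dwheelBoundaryLength X k l ≤ m
  -- The vertex u whose link contains the dwheel would span a 3-simplex with the triangle w_last v₀ v₁.
  noShortFullDwheel {k = k} {l} {v} {w} dim (_ , located) (dwheel , v-full , w-full) short
    with located k l v w dwheel short v-full w-full
  ... | u , v-in-link , _ with v-in-link _ (inj₂ (zero , inj₂ (inj₂ (inj₂ refl))))
  ... | u∉t , t∪u-face =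
    u∉t (∣p∣≤3⇒⊆triangle (dim _ t∪u-face)
           (x∈p∪q⁺ (inj₁ ∈triangle₁)) (x∈p∪q⁺ (inj₁ ∈triangle₂)) (x∈p∪q⁺ (inj₁ ∈triangle₃))
           (centre≢ zero) (centre≢ (next zero)) v0≢v1
           (x∈p∪q⁺ (inj₂ (x∈⁅x⁆ u))))
    where
    centre≢ : ∀ i → w (lastIx l) ≢ v i
    centre≢ = proj₁ (proj₂ (proj₁ dwheel))
    v0≢v1 : v zero ≢ v (next zero)
    v0≢v1 v0≡v1 = 0≢1+n (trans (proj₁ (proj₁ dwheel) v0≡v1) (next-inject₁ zero))

long-boundary⇒12≤ : ∀ {k l a b} → ¬ l + k + 2 ≤ 7 → 3 + k ≤ a → 3 + l ≤ b → 12 ≤ a + b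
long-boundary⇒12≤ {k} {l} {a} {b} long 3+k≤a 3+l≤b = begin
  12                  ≤⟨ +-monoˡ-≤ 4 (≰⇒> long) ⟩
  l + k + 2 + 4       ≡⟨ solve (k ∷ l ∷ []) ⟩
  (3 + k) + (3 + l)   ≤⟨ +-mono-≤ 3+k≤a 3+l≤b ⟩
  a + b               ∎
  where open ≤-Reasoning

lemma4p1 : ∀ {n : ℕ} (D : SComplex n) → IsDisc D → Located D 7 →
           ∀ v w → Adj D v w → Interior D v → Interior D w →
           12 ≤ deg D v + deg D w
lemma4p1 D (dim , links , _) located@(flag , _) x y x~y x-interior y-interior
  with interior⇒IsLinkCycle D links x-interior | interior⇒IsLinkCycle D links y-interior
... | kx , bx , bx-cyc | ky , by , by-cyc =
  let (v , w , full-dwheel) = adjacent⇒FullDwheel D flag dim x~y bx-cyc by-cyc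
  in long-boundary⇒12≤ (noShortFullDwheel D dim located full-dwheel)
                       (IsLinkCycle⇒3+k≤deg D bx-cyc) (IsLinkCycle⇒3+k≤deg D by-cyc)
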